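{- The class of bipartite graphs and the class of trees are both FOLB-definable (as classes of finite connected graphs).
   Context: All graphs are finite, simple, undirected and connected; $d$ denotes the shortest-path distance. For such a graph $G=(V,E)$, its graphic interval (betweenness) structure is $(V,B_G)$ where $B_G(u,x,v)$ holds iff $d(u,x)+d(x,v)=d(u,v)$. A class $\mathcal{C}$ of finite connected graphs is FOLB-definable if there is a first-order sentence $\varphi$ over the vocabulary consisting of one ternary relation symbol $B$ (with equality) such that for every finite connected graph $G$, $(V,B_G)\models\varphi$ iff $G\in\mathcal{C}$. A tree is a connected acyclic graph. -}

module Defs where

open import Data.Nat using (ℕ; zero; suc; _+_; _≤_)
open import Data.Fin using (Fin; zero; suc; inject₁; fromℕ)
open import Data.Bool using (Bool; true; false)
open import Data.Product using (Σ; ∃; ∃-syntax; _×_; _,_)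
open import Data.Sum using (_⊎_)
open import Data.Empty using (⊥)
open import Relation.Nullary using (¬_)
open import Relation.Binary.PropositionalEquality using (_≡_)
open import Function.Definitions using (Injective)
open import Function.Bundles using (_⇔_)

record Graph : Set where
  field
    n       : ℕ
    adj     : Fin n → Fin n → Bool
    adj-sym : ∀ u v → adj u v ≡ adj v u
    irrefl  : ∀ v → adj v v ≡ false

module _ (G : Graph) where
  open Graph G

  Vertex : Set
  Vertex = Fin n

  Edge : Vertex → Vertex → Set
  Edge u v = adj u v ≡ true

  data Walk : Vertex → Vertex → ℕ → Set where
    here : ∀ {u} → Walk u u 0
    step : ∀ {u w v k} → Edge u w → Walk w v k → Walk u v (suc k)

  Dist : Vertex → Vertex → ℕ → Set
  Dist u v k = Walk u v k × (∀ m → Walk u v m → k ≤ m)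

  Connected : Set
  Connected = Vertex × (∀ u v → ∃[ k ] Walk u v k)

  Betw : Vertex → Vertex → Vertex → Set
  Betw u x v = ∃[ a ] ∃[ b ] (Dist u x a × Dist x v b × Dist u v (a + b))

  Bipartite : Set
  Bipartite = Σ (Vertex → Bool) λ c → ∀ u v → Edge u v → ¬ (c u ≡ c v)

  record Cycle : Set where
    field
      k        : ℕ
      c        : Fin (3 + k) → Vertex
      distinct : Injective _≡_ _≡_ c
      consec   : ∀ (i : Fin (2 + k)) → Edge (c (inject₁ i)) (c (suc i))
      closing  : Edge (c (fromℕ (2 + k))) (c zero)

  Acyclic : Set
  Acyclic = ¬ Cycle

  Tree : Set
  Tree = Connected × Acyclic

-- First-order logic over one ternary relation symbol B (with equality).
-- Formulas with de Bruijn variables; Formula m has m free variables.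

data Formula : ℕ → Set where
  B    : ∀ {m} → Fin m → Fin m → Fin m → Formula m
  eq   : ∀ {m} → Fin m → Fin m → Formula m
  fls  : ∀ {m} → Formula m
  neg  : ∀ {m} → Formula m → Formula m
  and  : ∀ {m} → Formula m → Formula m → Formula m
  or   : ∀ {m} → Formula m → Formula m → Formula m
  imp  : ∀ {m} → Formula m → Formula m → Formula m
  all  : ∀ {m} → Formula (suc m) → Formula m
  ex   : ∀ {m} → Formula (suc m) → Formula m

Sentence : Set
Sentence = Formula 0

record BStructure : Set₁ where
  field
    Carrier : Set
    Rel     : Carrier → Carrier → Carrier → Set

extend : ∀ {A : Set} {m} → A → (Fin m → A) → Fin (suc m) → A
extend a ρ zero    = a
extend a ρ (suc i) = ρ i

Sat : (M : BStructure) → ∀ {m} → Formula m → (Fin m → BStructure.Carrier M) → Set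
Sat M (B i j l) ρ = BStructure.Rel M (ρ i) (ρ j) (ρ l)
Sat M (eq i j)  ρ = ρ i ≡ ρ j
Sat M fls       ρ = ⊥
Sat M (neg φ)   ρ = ¬ Sat M φ ρ
Sat M (and φ ψ) ρ = Sat M φ ρ × Sat M ψ ρ
Sat M (or φ ψ)  ρ = Sat M φ ρ ⊎ Sat M ψ ρ
Sat M (imp φ ψ) ρ = Sat M φ ρ → Sat M ψ ρ
Sat M (all φ)   ρ = ∀ a → Sat M φ (extend a ρ)
Sat M (ex φ)    ρ = Σ (BStructure.Carrier M) λ a → Sat M φ (extend a ρ)

noVars : ∀ {A : Set} → Fin 0 → A
noVars ()

_⊨_ : BStructure → Sentence → Set
M ⊨ φ = Sat M φ noVars

intervalStructure : Graph → BStructure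
intervalStructure G = record { Carrier = Vertex G ; Rel = Betw G }

FOLBDefinable : (Graph → Set) → Set
FOLBDefinable C =
  Σ Sentence λ φ → ∀ (G : Graph) → Connected G → ((intervalStructure G ⊨ φ) ⇔ C G)

{-# OPTIONS --safe #-}
-- Adjacency is definable from betweenness: u, v are adjacent iff u ≠ v and
-- nothing lies strictly between them.  A connected graph is bipartite iff,
-- for every root x, the two ends of an edge are at different distances
-- from x, i.e. one lies between x and the other.  A connected bipartite
-- graph is a tree iff every vertex has at most one parent with respect to
-- every root: in a tree two parents would close a cycle through their
-- child, and conversely, on a cycle a vertex farthest from a root has both
-- of its cycle-neighbours as parents.
module Submission where

open import Defs
open import Data.Bool using (Bool; true; false; not; _xor_) renaming (_≟_ to _≟ᵇ_)
open import Data.Bool.Properties using (not-¬; ¬-not; not-distribˡ-xor; not-distribʳ-xor; xor-identityʳ)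
open import Data.Empty using (⊥-elim)
open import Data.Fin using (Fin; zero; suc; inject₁; fromℕ; #_)
open import Data.Fin.Properties using (any?) renaming (_≟_ to _≟ᶠ_; suc-injective to fsuc-injective)
open import Data.List using (List; []; _∷_; allFin)
open import Data.List.Extrema.Nat using (argmax; f[xs]≤f[argmax])
open import Data.List.Membership.Propositional using (_∈_; _∉_)
open import Data.List.Membership.Propositional.Properties using (∈-allFin)
import Data.List.Membership.DecPropositional as DecMembership
open import Data.List.Relation.Unary.All as All using (All; []; _∷_)
open import Data.List.Relation.Unary.Any using (here; there)
open import Data.Nat using (ℕ; zero; suc; _+_; _≤_; z≤n; s≤s)
open import Data.Nat.Properties
  using (≤-antisym; ≤-refl; <-cmp; <⇒≱; <-≤-trans; m<m+n; m≤m+n; +-comm; +-suc; ≤-pred; 1+n≰n; n≤1+n)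
open import Data.Product using (_×_; ∃-syntax; _,_; proj₁; proj₂; uncurry)
open import Data.Sum using (_⊎_; inj₁; inj₂)
open import Function.Base using (_∘_)
open import Function.Bundles using (mk⇔)
open import Function.Definitions using (Injective)
open import Relation.Binary.Definitions using (tri<; tri≈; tri>)
open import Relation.Binary.PropositionalEquality
open import Relation.Nullary using (¬_; Dec; yes; no)
open import Relation.Nullary.Decidable using (_×-dec_)
import Relation.Unary as U

Least : (ℕ → Set) → Set
Least P = ∃[ m ] (P m × (∀ j → P j → m ≤ j))

least : ∀ {P : ℕ → Set} → U.Decidable P → ∀ {k} → P k → Least P
least P? {zero} p = 0 , p , λ _ _ → z≤n
least P? {suc k} p with P? 0
... | yes p₀ = 0 , p₀ , λ _ _ → z≤n
... | no ¬p₀ with least (λ j → P? (suc j)) p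
...   | m , pm , minimal = suc m , pm , λ where
  zero    p₀ → ⊥-elim (¬p₀ p₀)
  (suc j) pj → s≤s (minimal j pj)

within-one : ∀ {a b} → a ≤ suc b → b ≤ suc a → b ≡ suc a ⊎ a ≡ b ⊎ a ≡ suc b
within-one {a} {b} a≤1+b b≤1+a with <-cmp a b
... | tri< a<b _ _ = inj₁ (≤-antisym b≤1+a a<b)
... | tri≈ _ a≡b _ = inj₂ (inj₁ a≡b)
... | tri> _ _ b<a = inj₂ (inj₂ (≤-antisym a≤1+b b<a))

parity : ℕ → Bool
parity zero    = false
parity (suc n) = not (parity n)

parity-suc≢ : ∀ n → parity (suc n) ≢ parity n
parity-suc≢ n same = not-¬ refl (sym same)

last-or-inject₁ : ∀ {m} (i : Fin (suc m)) → i ≡ fromℕ m ⊎ ∃[ j ] i ≡ inject₁ j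
last-or-inject₁ {zero}  zero    = inj₁ refl
last-or-inject₁ {suc m} zero    = inj₂ (zero , refl)
last-or-inject₁ {suc m} (suc i) with last-or-inject₁ i
... | inj₁ i≡last     = inj₁ (cong suc i≡last)
... | inj₂ (j , i≡j) = inj₂ (suc j , cong suc i≡j)

inject₁²≢suc² : ∀ {m} (i : Fin m) → inject₁ (inject₁ i) ≢ suc (suc i)
inject₁²≢suc² (suc i) i≡j = inject₁²≢suc² i (fsuc-injective i≡j)

argmax-Fin : ∀ m (f : Fin (suc m) → ℕ) → ∃[ i ] (∀ j → f j ≤ f i)
argmax-Fin m f = i , λ j → All.lookup (f[xs]≤f[argmax] {f = f} zero (allFin (suc m))) (∈-allFin j)
  where i = argmax f zero (allFin (suc m))

module _ (G : Graph) where
  open Graph G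

  private
    V : Set
    V = Vertex G

    E : V → V → Set
    E = Edge G

    W : V → V → ℕ → Set
    W = Walk G

    variable
      a b r s u v w x y : V
      i j k d : ℕ

  edge-sym : E u v → E v u
  edge-sym {u} {v} e = trans (adj-sym v u) e

  edge⇒≢ : E u v → u ≢ v
  edge⇒≢ {u} e refl with trans (sym e) (irrefl u)
  ... | ()

  snoc : W u x k → E x v → W u v (suc k)
  snoc here        e = step e here
  snoc (step e′ p) e = step e′ (snoc p e)

  reverse : W u v k → W v u k
  reverse here       = here
  reverse (step e p) = snoc (reverse p) (edge-sym e)

  _++ʷ_ : W u x i → W x v j → W u v (i + j)
  here     ++ʷ q = q
  step e p ++ʷ q = step e (p ++ʷ q)

  unsnoc : W u v (suc k) → ∃[ y ] (W u y k × E y v)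
  unsnoc (step e here)        = _ , here , e
  unsnoc (step e (step e′ p)) with unsnoc (step e′ p)
  ... | y , q , e″ = y , step e q , e″

  vertices : W u v k → List V
  vertices (here {u = u})     = u ∷ []
  vertices (step {u = u} _ p) = u ∷ vertices p

  module _ {P : V → Set} where

    All-snoc : (p : W u x k) (e : E x v) → All P (vertices p) → P v → All P (vertices (snoc p e))
    All-snoc here       e (px ∷ []) pv = px ∷ pv ∷ []
    All-snoc (step _ p) e (pu ∷ ps) pv = pu ∷ All-snoc p e ps pv

    All-reverse : (p : W u v k) → All P (vertices p) → All P (vertices (reverse p))
    All-reverse here       ps        = ps
    All-reverse (step e p) (pu ∷ ps) = All-snoc (reverse p) (edge-sym e) (All-reverse p ps) pu

    All-++ʷ : (p : W u x i) (q : W x v j) → All P (vertices p) → All P (vertices q) → All P (vertices (p ++ʷ q))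
    All-++ʷ here       q _         qs = qs
    All-++ʷ (step e p) q (pu ∷ ps) qs = pu ∷ All-++ʷ p q ps qs

  walk? : ∀ u v k → Dec (W u v k)
  walk? u v zero with u ≟ᶠ v
  ... | yes refl = yes here
  ... | no u≢v   = no λ { here → u≢v refl }
  walk? u v (suc k) with any? (λ w → (adj u w ≟ᵇ true) ×-dec walk? w v k)
  ... | yes (w , e , p) = yes (step e p)
  ... | no ¬step        = no λ { (step e p) → ¬step (_ , e , p) }

  dist-exists : W u v k → ∃[ d ] Dist G u v d
  dist-exists {u} {v} = least (walk? u v)

  dist-unique : Dist G u v i → Dist G u v j → i ≡ j
  dist-unique (p , minp) (q , minq) = ≤-antisym (minp _ q) (minq _ p)

  dist-refl⇒≡ : Dist G u v 0 → u ≡ v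
  dist-refl⇒≡ (here , _) = refl

  dist-edge : E u v → Dist G u v 1
  dist-edge e = step e here , λ where
    zero    here → ⊥-elim (edge⇒≢ e refl)
    (suc m) _    → s≤s z≤n

  dist-tail : E u y → W y v k → Dist G u v (suc k) → Dist G y v k
  dist-tail e q (_ , minimal) = q , λ m q′ → ≤-pred (minimal _ (step e q′))

  dist-across-edge : E u v → Dist G r u i → Dist G r v j → j ≡ suc i ⊎ i ≡ j ⊎ i ≡ suc j
  dist-across-edge e (p , minp) (q , minq) =
    within-one (minp _ (snoc q (edge-sym e))) (minq _ (snoc p e))

  between-edge⇒dist-suc : Betw G r x y → E x y → Dist G r x i → Dist G r y j → j ≡ suc i
  between-edge⇒dist-suc (_ , _ , drx , dxy , dry) e dx dy
    rewrite dist-unique dxy (dist-edge e) | dist-unique drx dx | dist-unique dy dry = +-comm _ 1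

  dist-suc⇒between : Dist G r x i → E x y → Dist G r y (suc i) → Betw G r x y
  dist-suc⇒between {i = i} dx e dy = i , 1 , dx , dist-edge e , subst (Dist G _ _) (+-comm 1 i) dy

  Adjacent : V → V → Set
  Adjacent u v = (u ≢ v) × (∀ y → Betw G u y v → y ≡ u ⊎ y ≡ v)

  edge⇒adjacent : E u v → Adjacent u v
  edge⇒adjacent e = edge⇒≢ e , λ { y (_ , _ , duy , dyv , duv) → ends (dist-unique duv (dist-edge e)) duy dyv }
    where
    ends : i + j ≡ 1 → Dist G u y i → Dist G y v j → y ≡ u ⊎ y ≡ v
    ends {zero}        refl duy _   = inj₁ (sym (dist-refl⇒≡ duy))
    ends {suc zero}    refl _   dyv = inj₂ (dist-refl⇒≡ dyv)
    ends {suc (suc _)} ()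

  AllConnected : Set
  AllConnected = ∀ u v → ∃[ k ] W u v k

  adjacent⇒edge : AllConnected → Adjacent u v → E u v
  adjacent⇒edge {u} {v} conn (u≢v , only-ends) with dist-exists (proj₂ (conn u v))
  ... | zero  , duv                = ⊥-elim (u≢v (dist-refl⇒≡ duv))
  ... | suc d , duv@(step e q , _) with only-ends _ (1 , d , dist-edge e , dist-tail e q duv , duv)
  ...   | inj₁ refl = ⊥-elim (edge⇒≢ e refl)
  ...   | inj₂ refl = e

  module Depth (conn : AllConnected) (r : V) where

    depth : V → ℕ
    depth v = proj₁ (dist-exists (proj₂ (conn r v)))

    depth-dist : ∀ v → Dist G r v (depth v)
    depth-dist v = proj₂ (dist-exists (proj₂ (conn r v)))

    parity-colouring : (∀ {u v} → E u v → depth v ≡ suc (depth u) ⊎ depth u ≡ suc (depth v)) → Bipartite G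
    parity-colouring layered = parity ∘ depth , proper
      where
      proper : ∀ u v → E u v → parity (depth u) ≢ parity (depth v)
      proper u v e same with layered e
      ... | inj₁ v-deeper = parity-suc≢ (depth u) (trans (cong parity (sym v-deeper)) (sym same))
      ... | inj₂ u-deeper = parity-suc≢ (depth v) (trans (cong parity (sym u-deeper)) same)

  -- Generalised over a prefix q from r, so that the length bound survives the induction along p.
  avoids-after : Dist G r w d → W r s j → (p : W s x k) → j + k ≤ d → x ≢ w →
                 All (_≢ w) (vertices p)
  avoids-after _ _ here _ x≢w = x≢w ∷ []
  avoids-after {d = d} {j = j} {k = suc k} drw q (step e p) j+k≤d x≢w =
    s≢w ∷ avoids-after drw (snoc q e) p (subst (_≤ d) (+-suc j k) j+k≤d) x≢w
    where
    s≢w : _ ≢ _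
    s≢w refl = <⇒≱ (<-≤-trans (m<m+n j (s≤s z≤n)) j+k≤d) (proj₂ drw j q)

  walk-avoids : Dist G r w d → (p : W r x k) → k ≤ d → x ≢ w → All (_≢ w) (vertices p)
  walk-avoids drw = avoids-after drw here

  data SimplePath : V → V → List V → Set where
    stop : SimplePath b b (b ∷ [])
    cons : ∀ {vs} → E a u → a ∉ vs → SimplePath u b vs → SimplePath a b (a ∷ vs)

  module _ {P : V → Set} where

    simple-suffix : ∀ {vs} → SimplePath u b vs → a ∈ vs → All P vs →
                    ∃[ ws ] (SimplePath a b ws × All P ws)
    simple-suffix stop           (here refl) ps       = _ , stop , ps
    simple-suffix (cons e a∉ sp) (here refl) ps       = _ , cons e a∉ sp , ps
    simple-suffix (cons _ _ sp)  (there a∈)  (_ ∷ ps) = simple-suffix sp a∈ ps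

    shortcut : (p : W a b k) → All P (vertices p) → ∃[ vs ] (SimplePath a b vs × All P vs)
    shortcut here ps = _ , stop , ps
    shortcut {a = a} (step e p) (pa ∷ ps) with shortcut p ps
    ... | vs , sp , pvs with DecMembership._∈?_ _≟ᶠ_ a vs
    ...   | yes a∈ = simple-suffix sp a∈ pvs
    ...   | no a∉  = _ , cons e a∉ sp , pa ∷ pvs

  record Enumeration (a b : V) (vs : List V) : Set where
    constructor enumeration
    field
      len          : ℕ
      at           : Fin (suc len) → V
      at-first     : at zero ≡ a
      at-last      : at (fromℕ len) ≡ b
      at-edge      : ∀ i → E (at (inject₁ i)) (at (suc i))
      at-injective : Injective _≡_ _≡_ at
      at-∈         : ∀ i → at i ∈ vs

  enumerate : ∀ {vs} → SimplePath a b vs → Enumeration a b vs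
  enumerate {b = b} stop = record
    { len = 0 ; at = λ _ → b ; at-first = refl ; at-last = refl ; at-edge = λ ()
    ; at-injective = λ { {zero} {zero} _ → refl } ; at-∈ = λ _ → here refl }
  enumerate {a = a} {vs = a ∷ vs} (cons e a∉ sp) = record
    { len = suc len ; at = at′ ; at-first = refl ; at-last = at-last
    ; at-edge = at′-edge ; at-injective = at′-injective ; at-∈ = at′-∈ }
    where
    open Enumeration (enumerate sp)

    at′ : Fin (suc (suc len)) → V
    at′ zero    = a
    at′ (suc i) = at i

    at′-edge : ∀ i → E (at′ (inject₁ i)) (at′ (suc i))
    at′-edge zero    = subst (E a) (sym at-first) e
    at′-edge (suc i) = at-edge i

    at′-injective : Injective _≡_ _≡_ at′
    at′-injective {zero}  {zero}  _    = refl
    at′-injective {zero}  {suc j} same = ⊥-elim (a∉ (subst (_∈ vs) (sym same) (at-∈ j)))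
    at′-injective {suc i} {zero}  same = ⊥-elim (a∉ (subst (_∈ vs) same (at-∈ i)))
    at′-injective {suc i} {suc j} same = cong suc (at-injective same)

    at′-∈ : ∀ i → at′ i ∈ a ∷ vs
    at′-∈ zero    = here refl
    at′-∈ (suc i) = there (at-∈ i)

  close-cycle : ∀ {vs} → a ≢ b → E w a → E b w → All (_≢ w) vs → Enumeration a b vs → Cycle G
  close-cycle a≢b _ _ _ (enumeration zero at at-first at-last _ _ _) =
    ⊥-elim (a≢b (trans (sym at-first) at-last))
  close-cycle {w = w} _ ewa ebw avoid (enumeration (suc k) at at-first at-last at-edge at-injective at-∈) = record
    { k = k ; c = c ; distinct = c-injective ; consec = c-edge
    ; closing = subst (λ z → E z w) (sym at-last) ebw }
    where
    c : Fin (3 + k) → V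
    c zero    = w
    c (suc i) = at i

    c-injective : Injective _≡_ _≡_ c
    c-injective {zero}  {zero}  _    = refl
    c-injective {zero}  {suc j} same = ⊥-elim (All.lookup avoid (at-∈ j) (sym same))
    c-injective {suc i} {zero}  same = ⊥-elim (All.lookup avoid (at-∈ i) same)
    c-injective {suc i} {suc j} same = cong suc (at-injective same)

    c-edge : ∀ i → E (c (inject₁ i)) (c (suc i))
    c-edge zero    = subst (E w) (sym at-first) ewa
    c-edge (suc i) = at-edge i

  cycle-through : a ≢ b → E w a → E b w → (p : W a b k) → All (_≢ w) (vertices p) → Cycle G
  cycle-through a≢b ewa ebw p avoid with shortcut p avoid
  ... | vs , sp , avoid-vs = close-cycle a≢b ewa ebw avoid-vs (enumerate sp)

  cycle-from-branches : a ≢ b → E a w → E b w → (p : W r a i) (q : W r b j) →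
                        All (_≢ w) (vertices p) → All (_≢ w) (vertices q) → Cycle G
  cycle-from-branches a≢b eaw ebw p q p-avoids q-avoids =
    cycle-through a≢b (edge-sym eaw) ebw (reverse p ++ʷ q)
      (All-++ʷ (reverse p) q (All-reverse p p-avoids) q-avoids)

  equal-depth-edge⇒cycle : Dist G r u d → Dist G r v d → E u v → Cycle G
  equal-depth-edge⇒cycle {d = zero} dru drv e =
    ⊥-elim (edge⇒≢ e (trans (sym (dist-refl⇒≡ dru)) (dist-refl⇒≡ drv)))
  equal-depth-edge⇒cycle {d = suc d} dru@(P , _) (Q , minQ) e with unsnoc P
  ... | p , P′ , epu = cycle-from-branches p≢v epu (edge-sym e) P′ Q
                         (walk-avoids dru P′ (n≤1+n d) (edge⇒≢ epu))
                         (walk-avoids dru Q ≤-refl (edge⇒≢ (edge-sym e)))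
    where
    p≢v : p ≢ _
    p≢v refl = 1+n≰n (minQ d P′)

  IntervalBipartite : Set
  IntervalBipartite = ∀ x u v → Adjacent u v → Betw G x u v ⊎ Betw G x v u

  UniqueParents : Set
  UniqueParents = ∀ r w a b → Adjacent a w × (Adjacent b w × (Betw G r a w × Betw G r b w)) → a ≡ b

  interval-bipartite⇒bipartite : Connected G → IntervalBipartite → Bipartite G
  interval-bipartite⇒bipartite (r , conn) oriented = parity-colouring layered
    where
    open Depth conn r
    layered : E u v → depth v ≡ suc (depth u) ⊎ depth u ≡ suc (depth v)
    layered {u} {v} e with oriented r u v (edge⇒adjacent e)
    ... | inj₁ ruv = inj₁ (between-edge⇒dist-suc ruv e (depth-dist u) (depth-dist v))
    ... | inj₂ rvu = inj₂ (between-edge⇒dist-suc rvu (edge-sym e) (depth-dist v) (depth-dist u))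

  colour-along-walk : ((colour , _) : Bipartite G) → W x y k → colour y ≡ colour x xor parity k
  colour-along-walk _ here = sym (xor-identityʳ _)
  colour-along-walk {x = x} {y = y} {k = suc k} c@(colour , proper) (step {w = w} e p) = begin
    colour y                    ≡⟨ colour-along-walk c p ⟩
    colour w xor parity k       ≡⟨ cong (_xor parity k) (¬-not (≢-sym (proper x w e))) ⟩
    not (colour x) xor parity k ≡⟨ sym (not-distribˡ-xor (colour x) (parity k)) ⟩
    not (colour x xor parity k) ≡⟨ not-distribʳ-xor (colour x) (parity k) ⟩
    colour x xor parity (suc k) ∎
    where open ≡-Reasoning

  bipartite⇒interval-bipartite : Connected G → Bipartite G → IntervalBipartite
  bipartite⇒interval-bipartite (_ , conn) c@(colour , proper) x u v adj-uv
    with adjacent⇒edge conn adj-uv | dist-exists (proj₂ (conn x u)) | dist-exists (proj₂ (conn x v))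
  ... | e | i , dxu | j , dxv with dist-across-edge e dxu dxv
  ...   | inj₁ j≡1+i        = inj₁ (dist-suc⇒between dxu e (subst (Dist G x v) j≡1+i dxv))
  ...   | inj₂ (inj₂ i≡1+j) = inj₂ (dist-suc⇒between dxv (edge-sym e) (subst (Dist G x u) i≡1+j dxu))
  ...   | inj₂ (inj₁ refl)  =
    ⊥-elim (proper u v e (trans (colour-along-walk c (proj₁ dxu)) (sym (colour-along-walk c (proj₁ dxv)))))

  tree⇒bipartite : Connected G → Acyclic G → Bipartite G
  tree⇒bipartite (r , conn) acyclic = parity-colouring layered
    where
    open Depth conn r
    layered : E u v → depth v ≡ suc (depth u) ⊎ depth u ≡ suc (depth v)
    layered {u} {v} e with dist-across-edge e (depth-dist u) (depth-dist v)
    ... | inj₁ v-deeper        = inj₁ v-deeper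
    ... | inj₂ (inj₂ u-deeper) = inj₂ u-deeper
    ... | inj₂ (inj₁ level)    =
      ⊥-elim (acyclic (equal-depth-edge⇒cycle (depth-dist u) (subst (Dist G r v) (sym level) (depth-dist v)) e))

  tree⇒unique-parents : Connected G → Acyclic G → UniqueParents
  tree⇒unique-parents (_ , conn) acyclic r w a b
    (adj-aw , adj-bw , (i , _ , dra , _ , drw) , (j , _ , drb , _ , drw′)) with a ≟ᶠ b
  ... | yes a≡b = a≡b
  ... | no a≢b  = ⊥-elim (acyclic (cycle-from-branches a≢b eaw ebw (proj₁ dra) (proj₁ drb)
                    (walk-avoids drw (proj₁ dra) (m≤m+n i _) (edge⇒≢ eaw))
                    (walk-avoids drw′ (proj₁ drb) (m≤m+n j _) (edge⇒≢ ebw))))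
    where
    eaw : E a w
    eaw = adjacent⇒edge conn adj-aw
    ebw : E b w
    ebw = adjacent⇒edge conn adj-bw

  cycle-neighbours : (cy : Cycle G) → let open Cycle cy hiding (k) in
                     ∀ i → ∃[ p ] ∃[ q ] (p ≢ q × E (c p) (c i) × E (c q) (c i))
  cycle-neighbours cy zero =
    suc zero , fromℕ (2 + Cycle.k cy) , (λ ()) , edge-sym (consec zero) , closing
    where open Cycle cy hiding (k)
  cycle-neighbours cy (suc i) with last-or-inject₁ i
  ... | inj₁ refl = inject₁ i , zero , (λ ()) , consec i , edge-sym closing
    where open Cycle cy hiding (k)
  ... | inj₂ (j , refl) =
    inject₁ (inject₁ j) , suc (suc j) , inject₁²≢suc² j , consec (inject₁ j) , edge-sym (consec (suc j))
    where open Cycle cy hiding (k)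

  interval-bipartite∧unique-parents⇒acyclic : Connected G → IntervalBipartite → UniqueParents → Acyclic G
  interval-bipartite∧unique-parents⇒acyclic (_ , conn) oriented unique cy =
    uncurry not-farthest (argmax-Fin (2 + Cycle.k cy) (depth ∘ c))
    where
    open Cycle cy hiding (k)
    open Depth conn (c zero)

    not-farthest : ∀ i → ¬ (∀ j → depth (c j) ≤ depth (c i))
    not-farthest i farthest with cycle-neighbours cy i
    ... | p , q , p≢q , epi , eqi =
      p≢q (distinct (unique (c zero) (c i) (c p) (c q)
        (edge⇒adjacent epi , edge⇒adjacent eqi , parent p epi , parent q eqi)))
      where
      parent : ∀ x → E (c x) (c i) → Betw G (c zero) (c x) (c i)
      parent x e with oriented (c zero) (c x) (c i) (edge⇒adjacent e)
      ... | inj₁ between = between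
      ... | inj₂ beyond  = ⊥-elim (1+n≰n (subst (_≤ depth (c i))
              (between-edge⇒dist-suc beyond (edge-sym e) (depth-dist (c i)) (depth-dist (c x))) (farthest x)))

-- adj(i, j) := i ≠ j ∧ ∀ y. B(i, y, j) → y = i ∨ y = j
adjacentFormula : ∀ {m} → Fin m → Fin m → Formula m
adjacentFormula i j = and (neg (eq i j)) (all (imp (B (suc i) zero (suc j)) (or (eq zero (suc i)) (eq zero (suc j)))))

-- ∀ x u v. adj(u, v) → B(x, u, v) ∨ B(x, v, u)
bipartiteSentence : Sentence
bipartiteSentence = all (all (all (imp
  (adjacentFormula (# 1) (# 0))
  (or (B (# 2) (# 1) (# 0)) (B (# 2) (# 0) (# 1))))))

-- ∀ r w a b. adj(a, w) ∧ adj(b, w) ∧ B(r, a, w) ∧ B(r, b, w) → a = b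
uniqueParentsSentence : Sentence
uniqueParentsSentence = all (all (all (all (imp
  (and (adjacentFormula (# 1) (# 2))
    (and (adjacentFormula (# 0) (# 2))
      (and (B (# 3) (# 1) (# 2)) (B (# 3) (# 0) (# 2)))))
  (eq (# 1) (# 0))))))

-- The meaning of bipartiteSentence (resp. uniqueParentsSentence) in (V, B_G) unfolds
-- definitionally to IntervalBipartite G (resp. UniqueParents G).
bipartite-definable : FOLBDefinable Bipartite
bipartite-definable = bipartiteSentence , λ G conn →
  mk⇔ (interval-bipartite⇒bipartite G conn) (bipartite⇒interval-bipartite G conn)

tree-definable : FOLBDefinable Tree
tree-definable = and bipartiteSentence uniqueParentsSentence , λ G conn → mk⇔
  (λ (oriented , unique) → conn , interval-bipartite∧unique-parents⇒acyclic G conn oriented unique)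
  (λ (_ , acyclic) → bipartite⇒interval-bipartite G conn (tree⇒bipartite G conn acyclic) ,
                     tree⇒unique-parents G conn acyclic)

mainTheorem4 : FOLBDefinable Bipartite × FOLBDefinable Tree
mainTheorem4 = bipartite-definable , tree-definable
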